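{- Let $S\in\{0,1\}^n$ be a binary string and let $\delta:\{0,1\}\to\{0,1\}^*$ be defined by $\delta(0)=1$ and $\delta(1)=01$; write $\delta(S)=\delta(S[1])\delta(S[2])\cdots\delta(S[n])$. If $S$ has a Straight-Line Program of size $g$, then $\delta(S)$ has a Straight-Line Program of size at most $g+1$.
   Context: A Straight-Line Program (SLP) for a string is a context-free grammar generating exactly that string, in which every rule has the form $X\to AB$ where $A,B$ are terminals or nonterminals (right-hand sides of size two) and the grammar is acyclic. The size of an SLP is its number of nonterminals. -}

module Defs where

open import Data.Bool using (Bool; true; false)
open import Data.Nat using (ℕ; zero; suc)
open import Data.Fin using (Fin; zero; suc)
open import Data.List using (List; []; _∷_; _++_; concatMap)
open import Data.Sum using (_⊎_; inj₁; inj₂)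
open import Data.Product using (_×_; _,_; Σ)
open import Relation.Binary.PropositionalEquality using (_≡_)

-- Binary strings: lists of bits (false = 0, true = 1).
BinString : Set
BinString = List Bool

Sym : ℕ → Set
Sym i = Bool ⊎ Fin i

-- Acyclicity is enforced by
-- ordering: the rule X_i → A B may only refer to nonterminals X_j with j < i.
-- (Every acyclic grammar admits such a topological numbering.)
-- `Rules g` lists the rules of X_{g-1}, X_{g-2}, ..., X_0 (latest first).
data Rules : ℕ → Set where
  []  : Rules zero
  _∷_ : ∀ {g} → (Sym g × Sym g) → Rules g → Rules (suc g)

mutual
  expandNT : ∀ {g} → Rules g → Fin g → BinString
  expandNT ((a , b) ∷ rs) zero    = expandSym rs a ++ expandSym rs b
  expandNT (r ∷ rs)       (suc j) = expandNT rs j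

  expandSym : ∀ {g} → Rules g → Sym g → BinString
  expandSym rs (inj₁ c) = c ∷ []
  expandSym rs (inj₂ j) = expandNT rs j

-- Note: with this encoding, Fin (suc g)'s `zero` is the most recently added
-- (topmost) nonterminal, and `suc j` refers to the nonterminals below it.

record SLP (g : ℕ) : Set where
  field
    rules : Rules g
    start : Fin g

open SLP public

generated : ∀ {g} → SLP g → BinString
generated G = expandNT (rules G) (start G)

HasSLPOfSize : BinString → ℕ → Set
HasSLPOfSize S g = Σ (SLP g) λ G → generated G ≡ S

δbit : Bool → BinString
δbit false = true ∷ []
δbit true  = false ∷ true ∷ []

δ : BinString → BinString
δ = concatMap δbit

module Submission where

open import Defs
open import Data.Nat using (ℕ; _≤_; _+_; suc)
open import Data.Nat.Properties using (+-comm; ≤-reflexive)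
open import Data.Product using (Σ; _×_; _,_)
open import Data.Bool using (true; false)
open import Data.Sum using (inj₁; inj₂)
open import Data.Fin using (Fin; zero; suc; fromℕ; inject₁)
open import Data.List using ([]; _∷_; _++_)
open import Data.List.Properties using (concatMap-++)
open import Relation.Binary.PropositionalEquality using (_≡_; refl; sym; trans; cong; cong₂)
open Relation.Binary.PropositionalEquality.≡-Reasoning

-- δ is a morphism, so applying it to every terminal of an SLP for S yields a
-- grammar for δ(S). The terminal 0 becomes the terminal 1; the terminal 1
-- would become the two-letter word 01, which is not a symbol, so it is
-- replaced by one new nonterminal Z → 0 1. Hence g + 1 rules suffice.

-- Z is added as the lowest nonterminal, fromℕ g, so that every old
-- nonterminal j keeps its rule and is renamed to inject₁ j.
δSym : ∀ {g} → Sym g → Sym (suc g)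
δSym (inj₁ false) = inj₁ true
δSym {g} (inj₁ true) = inj₂ (fromℕ g)
δSym (inj₂ j) = inj₂ (inject₁ j)

δRules : ∀ {g} → Rules g → Rules (suc g)
δRules [] = (inj₁ false , inj₁ true) ∷ []
δRules ((a , b) ∷ rs) = (δSym a , δSym b) ∷ δRules rs

expandNT-δRules-fromℕ : ∀ {g} (rs : Rules g) → expandNT (δRules rs) (fromℕ g) ≡ δbit true
expandNT-δRules-fromℕ [] = refl
expandNT-δRules-fromℕ (_ ∷ rs) = expandNT-δRules-fromℕ rs

mutual
  expandNT-δRules : ∀ {g} (rs : Rules g) (j : Fin g) →
                    expandNT (δRules rs) (inject₁ j) ≡ δ (expandNT rs j)
  expandNT-δRules ((a , b) ∷ rs) zero = begin
    expandSym (δRules rs) (δSym a) ++ expandSym (δRules rs) (δSym b)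
      ≡⟨ cong₂ _++_ (expandSym-δSym rs a) (expandSym-δSym rs b) ⟩
    δ (expandSym rs a) ++ δ (expandSym rs b)
      ≡⟨ sym (concatMap-++ δbit (expandSym rs a) (expandSym rs b)) ⟩
    δ (expandSym rs a ++ expandSym rs b) ∎
  expandNT-δRules (_ ∷ rs) (suc j) = expandNT-δRules rs j

  expandSym-δSym : ∀ {g} (rs : Rules g) (s : Sym g) →
                   expandSym (δRules rs) (δSym s) ≡ δ (expandSym rs s)
  expandSym-δSym rs (inj₁ false) = refl
  expandSym-δSym rs (inj₁ true)  = expandNT-δRules-fromℕ rs
  expandSym-δSym rs (inj₂ j)     = expandNT-δRules rs j

δSLP : ∀ {g} → SLP g → SLP (suc g)
δSLP G = record { rules = δRules (rules G) ; start = inject₁ (start G) }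

generated-δSLP : ∀ {g} (G : SLP g) → generated (δSLP G) ≡ δ (generated G)
generated-δSLP G = expandNT-δRules (rules G) (start G)

lemma4 : (S : BinString) (g : ℕ) → HasSLPOfSize S g →
         Σ ℕ (λ g′ → (g′ ≤ g + 1) × HasSLPOfSize (δ S) g′)
lemma4 S g (G , G⇒S) =
  suc g , ≤-reflexive (+-comm 1 g) , δSLP G , trans (generated-δSLP G) (cong δ G⇒S)
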